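{- Let $p\ge3$ and $q\ge 2p-1$ be integers, let $a=\operatorname{achr}(K_p\square K_q)$, let $C$ be a set of $a$ colours with $\mathcal M^*(p,q,C)\neq\emptyset$, and let $d\notin C$. Then $\mathcal M^*(p,q+1,C\cup\{d\})\neq\emptyset$ and $\operatorname{achr}(K_p\square K_{q+1})\ge\operatorname{achr}(K_p\square K_q)+1$.
   Context: A vertex colouring $f:V(G)\to C$ of a finite simple graph $G$ is complete if for any two distinct $c_1,c_2\in C$ there are adjacent vertices $v_1,v_2$ with $f(v_1)=c_1$, $f(v_2)=c_2$. The achromatic number $\operatorname{achr}(G)$ is the maximum number of colours in a proper complete vertex colouring of $G$. The Cartesian product $G_1\square G_2$ has vertex set $V(G_1)\times V(G_2)$, with $(x_1,y_1)$ adjacent to $(x_2,y_2)$ iff either $x_1=x_2$ and $y_1y_2\in E(G_2)$, or $x_1x_2\in E(G_1)$ and $y_1=y_2$. For a finite set $C$, $\mathcal M(p,q,C)$ is the set of $p\times q$ matrices with entries in $C$ whose rows each consist of $q$ pairwise distinct elements, whose columns each consist of $p$ pairwise distinct elements, and such that every pair of distinct elements of $C$ occurs together in some row or column. $\mathcal M^*(p,q,C)$ is the subset of $\mathcal M(p,q,C)$ consisting of those matrices in which every pair of distinct elements of $C$ occurs together in some row. -}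

module Defs where

open import Level using (0ℓ)
open import Data.Nat using (ℕ; suc; _≤_)
open import Data.Fin using (Fin)
open import Data.Product using (_×_; ∃; ∃-syntax; Σ-syntax)
open import Data.Sum using (_⊎_)
open import Relation.Binary.PropositionalEquality using (_≡_; _≢_)

record Graph : Set₁ where
  field
    V   : Set
    Adj : V → V → Set

open Graph public

-- In a complete graph K_n on Fin n, two vertices are adjacent iff distinct.
KK : ℕ → ℕ → Graph
KK p q = record
  { V   = Fin p × Fin q
  ; Adj = λ { (x₁ Data.Product., y₁) (x₂ Data.Product., y₂) →
               (x₁ ≡ x₂ × y₁ ≢ y₂) ⊎ (x₁ ≢ x₂ × y₁ ≡ y₂) } }

Proper : (G : Graph) {k : ℕ} → (V G → Fin k) → Set
Proper G f = ∀ v w → Adj G v w → f v ≢ f w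

Complete : (G : Graph) {k : ℕ} → (V G → Fin k) → Set
Complete G {k} f = ∀ (c₁ c₂ : Fin k) → c₁ ≢ c₂ →
  ∃[ v ] ∃[ w ] (Adj G v w × f v ≡ c₁ × f w ≡ c₂)

HasCompleteColouring : Graph → ℕ → Set
HasCompleteColouring G k = Σ[ f ∈ (V G → Fin k) ] (Proper G f × Complete G f)

IsAchr : Graph → ℕ → Set
IsAchr G a = HasCompleteColouring G a × (∀ k → HasCompleteColouring G k → k ≤ a)

Matrix : Set → ℕ → ℕ → Set
Matrix C p q = Fin p → Fin q → C

RowsDistinct : ∀ {C p q} → Matrix C p q → Set
RowsDistinct {p = p} {q} M = ∀ (i : Fin p) (j₁ j₂ : Fin q) → M i j₁ ≡ M i j₂ → j₁ ≡ j₂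

ColsDistinct : ∀ {C p q} → Matrix C p q → Set
ColsDistinct {p = p} {q} M = ∀ (j : Fin q) (i₁ i₂ : Fin p) → M i₁ j ≡ M i₂ j → i₁ ≡ i₂

InSomeRow : ∀ {C p q} → Matrix C p q → C → C → Set
InSomeRow M c₁ c₂ = ∃[ i ] ∃[ j₁ ] ∃[ j₂ ] (M i j₁ ≡ c₁ × M i j₂ ≡ c₂)

InSomeCol : ∀ {C p q} → Matrix C p q → C → C → Set
InSomeCol M c₁ c₂ = ∃[ j ] ∃[ i₁ ] ∃[ i₂ ] (M i₁ j ≡ c₁ × M i₂ j ≡ c₂)

InM : (p q : ℕ) (C : Set) → Matrix C p q → Set
InM p q C M = RowsDistinct M × ColsDistinct M ×
  (∀ (c₁ c₂ : C) → c₁ ≢ c₂ → InSomeRow M c₁ c₂ ⊎ InSomeCol M c₁ c₂)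

InM* : (p q : ℕ) (C : Set) → Matrix C p q → Set
InM* p q C M = InM p q C M × (∀ (c₁ c₂ : C) → c₁ ≢ c₂ → InSomeRow M c₁ c₂)

M*NonEmpty : ℕ → ℕ → Set → Set
M*NonEmpty p q C = Σ[ M ∈ Matrix C p q ] InM* p q C M

module Submission where

open import Defs
open import Data.Nat using (ℕ; suc; _≤_; _+_; _*_; _∸_)
open import Data.Fin using (Fin)
open import Data.Product using (_×_)

open import Data.Nat using (zero; z≤n; s≤s; s≤s⁻¹; _<_)
import Data.Nat.Properties as ℕ
open import Data.Fin using (zero; suc; join; splitAt)
open import Data.Fin.Properties using (all?; any?; ¬∀⟶∃¬; injective⇒≤; splitAt-join; suc-injective)
  renaming (_≟_ to _≟ᶠ_)
open import Data.Product using (∃-syntax; _,_; proj₁; proj₂)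
open import Data.Sum using (_⊎_; inj₁; inj₂)
import Data.Sum as Sum
open import Function using (_∘_)
open import Function.Definitions using (Injective)
open import Relation.Nullary using (Dec; yes; no; contradiction)
open import Relation.Nullary.Decidable using (_⊎-dec_)
open import Relation.Binary.Definitions using (DecidableEquality)
open import Relation.Binary.PropositionalEquality using (_≡_; _≢_; refl; sym; trans; cong)

-- Pick in every row i of M a cell (i, J i) such that the columns J i are distinct and the
-- chosen entries are distinct colours; greedily, a row only has to avoid the columns and
-- colours of the p - 1 rows picked before it, and 2p - 1 ≤ q leaves room for that.
-- Now prepend a column holding the chosen entries and put the new colour d into the vacated
-- cells.  Each row keeps its colours and gains d, so every pair of colours still shares a
-- row, while the new column and the cells holding d have no repeats.  A matrix of
-- 𝓜*(p,q,C) is a complete colouring of K_p □ K_q, so the achromatic number grows by one.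

Injection : {A B : Set} → (A → B) → Set
Injection = Injective _≡_ _≡_

join-injective : ∀ m n → Injection (join m n)
join-injective m n {x} {y} e =
  trans (sym (splitAt-join m n x)) (trans (cong (splitAt m) e) (splitAt-join m n y))

cons-injective : {B : Set} {k : ℕ} (f : Fin (suc k) → B) →
  Injection (f ∘ suc) → (∀ i → f (suc i) ≢ f zero) → Injection f
cons-injective f f∘suc-inj fresh {zero}  {zero}  e = refl
cons-injective f f∘suc-inj fresh {zero}  {suc y} e = contradiction (sym e) (fresh y)
cons-injective f f∘suc-inj fresh {suc x} {zero}  e = contradiction e (fresh x)
cons-injective f f∘suc-inj fresh {suc x} {suc y} e = cong suc (f∘suc-inj e)

module _ {A : Set} (_≟_ : DecidableEquality A) where

  module _ {q k : ℕ} {row : Fin q → A} (row-inj : Injection row)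
           (cols : Fin k → Fin q) (vals : Fin k → A) where

    private
      Blocked : Fin q → Set
      Blocked j = (∃[ i ] cols i ≡ j) ⊎ (∃[ i ] vals i ≡ row j)

      blocked? : ∀ j → Dec (Blocked j)
      blocked? j = any? (λ i → cols i ≟ᶠ j) ⊎-dec any? (λ i → vals i ≟ row j)

      blocker : ∀ {j} → Blocked j → Fin k ⊎ Fin k
      blocker = Sum.map proj₁ proj₁

      blocker-determines : ∀ {j j′} (b : Blocked j) (b′ : Blocked j′) →
        blocker b ≡ blocker b′ → j ≡ j′
      blocker-determines (inj₁ (i , e)) (inj₁ (.i , e′)) refl = trans (sym e) e′
      blocker-determines (inj₂ (i , e)) (inj₂ (.i , e′)) refl = row-inj (trans (sym e) e′)

      all-blocked-injects : (∀ j → Blocked j) → q ≤ k + k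
      all-blocked-injects blocked = injective⇒≤ λ {x} {y} e →
        blocker-determines (blocked x) (blocked y) (join-injective k k e)

    avoiding-column : k + k < q → ∃[ j ] (∀ i → cols i ≢ j) × (∀ i → vals i ≢ row j)
    avoiding-column k+k<q with all? blocked?
    ... | yes blocked = contradiction (all-blocked-injects blocked) (ℕ.<⇒≱ k+k<q)
    ... | no ¬blocked with ¬∀⟶∃¬ q Blocked blocked? ¬blocked
    ...   | j , free = j , (λ i e → free (inj₁ (i , e))) , (λ i e → free (inj₂ (i , e)))

  record Transversal {p q : ℕ} (M : Matrix A p q) : Set where
    field
      column           : Fin p → Fin q
      column-injective : Injection column
      entry-injective  : Injection (λ i → M i (column i))

  transversal : {p q : ℕ} (M : Matrix A p q) → RowsDistinct M → p + p ≤ suc q → Transversal M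
  transversal {zero}  M rd _ = record { column = λ () ; column-injective = λ {} ; entry-injective = λ {} }
  transversal {suc k} {q} M rd 2p≤1+q = record
    { column           = column′
    ; column-injective = cons-injective column′ (column-injective rest) (proj₁ (proj₂ free))
    ; entry-injective  =
        cons-injective (λ i → M i (column′ i)) (entry-injective rest) (proj₂ (proj₂ free))
    }
    where
    open Transversal

    k+k<q : k + k < q
    k+k<q = ℕ.≤-trans (ℕ.≤-reflexive (sym (ℕ.+-suc k k))) (s≤s⁻¹ 2p≤1+q)

    rest : Transversal (M ∘ suc)
    rest = transversal (M ∘ suc) (rd ∘ suc) (ℕ.m≤n⇒m≤1+n (ℕ.<⇒≤ k+k<q))

    free : ∃[ j ] (∀ i → column rest i ≢ j) × (∀ i → M (suc i) (column rest i) ≢ M zero j)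
    free = avoiding-column (rd zero _ _) (column rest) (λ i → M (suc i) (column rest i)) k+k<q

    column′ : Fin (suc k) → Fin q
    column′ zero    = proj₁ free
    column′ (suc i) = column rest i

every-colour-occurs : {C : Set} {p q : ℕ} → DecidableEquality C → (M : Matrix C p q) →
  InM p q C M → Fin p → Fin q → ∀ c → ∃[ i ] ∃[ j ] M i j ≡ c
every-colour-occurs _≟_ M (_ , _ , pairs) i₀ j₀ c with M i₀ j₀ ≟ c
... | yes e = i₀ , j₀ , e
... | no ≢c with pairs c (M i₀ j₀) (≢c ∘ sym)
...   | inj₁ (i , j , _ , e , _) = i , j , e
...   | inj₂ (j , i , _ , e , _) = i , j , e

InM⇒HasCompleteColouring : {p q a : ℕ} (M : Matrix (Fin a) p q) →
  InM p q (Fin a) M → HasCompleteColouring (KK p q) a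
InM⇒HasCompleteColouring {p} {q} {a} M (rd , cd , pairs) = colour , proper , complete
  where
  colour : Fin p × Fin q → Fin a
  colour (i , j) = M i j

  proper : Proper (KK p q) colour
  proper (i , j) (.i , j′) (inj₁ (refl , j≢j′)) e = j≢j′ (rd i j j′ e)
  proper (i , j) (i′ , .j) (inj₂ (i≢i′ , refl)) e = i≢i′ (cd j i i′ e)

  complete : Complete (KK p q) colour
  complete c₁ c₂ c₁≢c₂ with pairs c₁ c₂ c₁≢c₂
  ... | inj₁ (i , j₁ , j₂ , e₁ , e₂) =
    (i , j₁) , (i , j₂) , inj₁ (refl , λ { refl → c₁≢c₂ (trans (sym e₁) e₂) }) , e₁ , e₂
  ... | inj₂ (j , i₁ , i₂ , e₁ , e₂) =
    (i₁ , j) , (i₂ , j) , inj₂ ((λ { refl → c₁≢c₂ (trans (sym e₁) e₂) }) , refl) , e₁ , e₂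

module Extension {p q a : ℕ} (M : Matrix (Fin a) p q) (M* : InM* p q (Fin a) M)
                 (T : Transversal _≟ᶠ_ M) where

  open Transversal T

  private
    rd : RowsDistinct M
    rd = proj₁ (proj₁ M*)

    cd : ColsDistinct M
    cd = proj₁ (proj₂ (proj₁ M*))

    pairs-in-rows : ∀ c₁ c₂ → c₁ ≢ c₂ → InSomeRow M c₁ c₂
    pairs-in-rows = proj₂ M*

  -- The new colour d is zero and suc embeds the old colours.
  extend : Matrix (Fin (suc a)) p (suc q)
  extend i zero = suc (M i (column i))
  extend i (suc j) with j ≟ᶠ column i
  ... | yes _ = zero
  ... | no  _ = suc (M i j)

  extend-rows-distinct : RowsDistinct extend
  extend-rows-distinct i zero zero _ = refl
  extend-rows-distinct i zero (suc j) e with j ≟ᶠ column i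
  ... | no j≢col = contradiction (sym (rd i _ _ (suc-injective e))) j≢col
  extend-rows-distinct i (suc j) zero e with j ≟ᶠ column i
  ... | no j≢col = contradiction (rd i _ _ (suc-injective e)) j≢col
  extend-rows-distinct i (suc j₁) (suc j₂) e with j₁ ≟ᶠ column i | j₂ ≟ᶠ column i
  ... | yes refl | yes refl = refl
  ... | no _     | no _     = cong suc (rd i _ _ (suc-injective e))

  extend-cols-distinct : ColsDistinct extend
  extend-cols-distinct zero i₁ i₂ e = entry-injective (suc-injective e)
  extend-cols-distinct (suc j) i₁ i₂ e with j ≟ᶠ column i₁ | j ≟ᶠ column i₂
  ... | yes j≡col₁ | yes j≡col₂ = column-injective (trans (sym j≡col₁) j≡col₂)
  ... | no _       | no _       = cd j i₁ i₂ (suc-injective e)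

  extend-new-colour : ∀ i → extend i (suc (column i)) ≡ zero
  extend-new-colour i with column i ≟ᶠ column i
  ... | yes _      = refl
  ... | no col≢col = contradiction refl col≢col

  extend-off-column : ∀ i {j} → j ≢ column i → extend i (suc j) ≡ suc (M i j)
  extend-off-column i {j} j≢col with j ≟ᶠ column i
  ... | yes j≡col = contradiction j≡col j≢col
  ... | no _      = refl

  extend-old-colour : ∀ i j → ∃[ j′ ] extend i j′ ≡ suc (M i j)
  extend-old-colour i j with j ≟ᶠ column i
  ... | yes refl = zero , refl
  ... | no j≢col = suc j , extend-off-column i j≢col

  extend-pairs-in-rows : (∀ c → ∃[ i ] ∃[ j ] M i j ≡ c) →
    ∀ c₁ c₂ → c₁ ≢ c₂ → InSomeRow extend c₁ c₂
  extend-pairs-in-rows occurs zero zero d≢d = contradiction refl d≢d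
  extend-pairs-in-rows occurs zero (suc c) _ with occurs c
  ... | i , j , refl with extend-old-colour i j
  ...   | j′ , e = i , suc (column i) , j′ , extend-new-colour i , e
  extend-pairs-in-rows occurs (suc c) zero _ with occurs c
  ... | i , j , refl with extend-old-colour i j
  ...   | j′ , e = i , j′ , suc (column i) , e , extend-new-colour i
  extend-pairs-in-rows occurs (suc c₁) (suc c₂) c₁≢c₂ with pairs-in-rows c₁ c₂ (c₁≢c₂ ∘ cong suc)
  ... | i , j₁ , j₂ , refl , refl with extend-old-colour i j₁ | extend-old-colour i j₂
  ...   | j₁′ , e₁ | j₂′ , e₂ = i , j₁′ , j₂′ , e₁ , e₂

  extend-∈M* : (∀ c → ∃[ i ] ∃[ j ] M i j ≡ c) → InM* p (suc q) (Fin (suc a)) extend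
  extend-∈M* occurs =
    (extend-rows-distinct , extend-cols-distinct , λ c₁ c₂ c₁≢c₂ → inj₁ (pairs c₁ c₂ c₁≢c₂)) , pairs
    where
    pairs : ∀ c₁ c₂ → c₁ ≢ c₂ → InSomeRow extend c₁ c₂
    pairs = extend-pairs-in-rows occurs

2p∸1≤q⇒p+p≤1+q : ∀ p q → 2 * p ∸ 1 ≤ q → p + p ≤ suc q
2p∸1≤q⇒p+p≤1+q zero    q _ = z≤n
2p∸1≤q⇒p+p≤1+q (suc p) q 2p∸1≤q rewrite ℕ.+-identityʳ p = s≤s 2p∸1≤q

lemma2p2 : (p q a : ℕ) → 3 ≤ p → 2 * p ∸ 1 ≤ q →
    IsAchr (KK p q) a →
    M*NonEmpty p q (Fin a) →
    M*NonEmpty p (suc q) (Fin (suc a)) ×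
    (∀ b → IsAchr (KK p (suc q)) b → suc a ≤ b)
-- Neither 3 ≤ p nor the value of achr(K_p □ K_q) is needed.
lemma2p2 p@(suc _) q a _ 2p∸1≤q _ (M , M*) =
  (extend , M⁺*) , λ b achr → proj₂ achr (suc a) (InM⇒HasCompleteColouring extend (proj₁ M⁺*))
  where
  T : Transversal _≟ᶠ_ M
  T = transversal _≟ᶠ_ M (proj₁ (proj₁ M*)) (2p∸1≤q⇒p+p≤1+q p q 2p∸1≤q)

  open Extension M M* T

  M⁺* : InM* p (suc q) (Fin (suc a)) extend
  M⁺* = extend-∈M* (every-colour-occurs _≟ᶠ_ M (proj₁ M*) zero (Transversal.column T zero))
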